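{- Let $r$ be a positive integer, $k\in\mathbb Z$, and $a_1,\dots,a_r$ nonzero complex numbers. Then for every integer $n\ge0$, \begin{align*} S_{n+1}^{(r,k)}(x|a_1,\dots,a_r)&=xS_n^{(r,k)}(x|a_1,\dots,a_r)-\frac{1}{n+1}\sum_{j=1}^r\sum_{l=0}^n\binom{n+1}{l}(-a_j)^{n+1-l}B_{n+1-l}S_l^{(r,k)}(x|a_1,\dots,a_r)\\ &\quad-\frac{1}{n+1}\left(S_{n+1}^{(r+1,k)}(x|a_1,\dots,a_r,1)-S_{n+1}^{(r+1,k-1)}(x|a_1,\dots,a_r,1)\right), \end{align*} where $B_m$ denotes the $m$th ordinary Bernoulli number.
   Context: For an integer $k$, ${\rm Li}_k(x)=\sum_{m=1}^\infty x^m/m^k$. For $r\in\mathbb Z_{>0}$, $k\in\mathbb Z$ and nonzero complex $a_1,\dots,a_r$, the polynomials $S_n^{(r,k)}(x|a_1,\dots,a_r)$ are defined by $\frac{t^r}{\prod_{j=1}^r(e^{a_jt}-1)}\frac{{\rm Li}_k(1-e^{ -t})}{1-e^{ -t}}e^{xt}=\sum_{n\ge0}S_n^{(r,k)}(x|a_1,\dots,a_r)\frac{t^n}{n!}$; thus $S_n^{(r+1,k')}(x|a_1,\dots,a_r,1)$ is the same with $r+1$ parameters, $a_{r+1}=1$ and $k'$ in place of $k$. Ordinary Bernoulli numbers: $\frac{t}{e^t-1}=\sum_{n\ge0}B_n\frac{t^n}{n!}$. -}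

module Defs where

open import Level using (Level; _⊔_) renaming (suc to lsuc)
open import Algebra.Bundles using (CommutativeRing)
open import Data.Nat using (ℕ; zero; suc; _∸_; _!)
open import Data.Nat.Combinatorics using (_C_)
open import Data.Integer using (ℤ; +_; -[1+_])
open import Data.Vec using (Vec; []; _∷_; head)
open import Relation.Nullary using (¬_)

module _ {c ℓ} (R : CommutativeRing c ℓ) where
  open CommutativeRing R
  natR : ℕ → Carrier
  natR zero = 0#
  natR (suc n) = 1# + natR n

-- A field of characteristic zero (stands in for ℂ): a commutative ring with
-- a (total) inverse operation that is a two-sided inverse on nonzero elements,
-- 1 ≠ 0, and n·1 ≠ 0 for every positive integer n.
record CharZeroField (c ℓ : Level) : Set (lsuc (c ⊔ ℓ)) where
  field
    commRing : CommutativeRing c ℓ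
  open CommutativeRing commRing public
  field
    _⁻¹ : Carrier → Carrier
    ⁻¹-inverse : ∀ x → ¬ (x ≈ 0#) → x * (x ⁻¹) ≈ 1#
    1≉0 : ¬ (1# ≈ 0#)
    charZero : ∀ n → ¬ (natR commRing (suc n) ≈ 0#)

-- Formal power series (ordinary coefficients: f n = [t^n] f) over the field.
module Series {c ℓ} (F : CharZeroField c ℓ) where
  open CharZeroField F

  ofℕ : ℕ → Carrier
  ofℕ = natR commRing

  pow : Carrier → ℕ → Carrier
  pow x zero = 1#
  pow x (suc n) = x * pow x n

  sumTo : ℕ → (ℕ → Carrier) → Carrier
  sumTo zero f = f 0
  sumTo (suc n) f = sumTo n f + f (suc n)

  sumVec : ∀ {r} → Vec Carrier r → (Carrier → Carrier) → Carrier
  sumVec [] f = 0#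
  sumVec (a ∷ as) f = f a + sumVec as f

  PS : Set c
  PS = ℕ → Carrier

  oneS : PS
  oneS zero = 1#
  oneS (suc n) = 0#

  mulS : PS → PS → PS
  mulS f g n = sumTo n (λ i → f i * g (n ∸ i))

  powS : PS → ℕ → PS
  powS f zero = oneS
  powS f (suc m) = mulS f (powS f m)

  invFact : ℕ → Carrier
  invFact n = (ofℕ (n !)) ⁻¹

  expS : Carrier → PS
  expS a n = pow a n * invFact n

  -- Multiplicative inverse of a power series g with g 0 invertible:
  -- h 0 = (g 0)⁻¹,  h (n+1) = -(g 0)⁻¹ · Σ_{i=1}^{n+1} g i · h (n+1-i).
  -- invList g n = [h n, h (n-1), ..., h 0].
  private
    dot : PS → ℕ → ∀ {m} → Vec Carrier m → Carrier
    dot g i [] = 0#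
    dot g i (h ∷ hs) = g i * h + dot g (suc i) hs

  invList : PS → (n : ℕ) → Vec Carrier (suc n)
  invList g zero = (g 0 ⁻¹) ∷ []
  invList g (suc n) = (- ((g 0 ⁻¹) * dot g 1 (invList g n))) ∷ invList g n

  invS : PS → PS
  invS g n = head (invList g n)

  -- (e^{a t} - 1) / t
  expm1DivT : Carrier → PS
  expm1DivT a n = pow a (suc n) * invFact (suc n)

  tOverExpm1 : Carrier → PS
  tOverExpm1 a = invS (expm1DivT a)

  -- t^r / ∏_j (e^{a_j t} - 1)  =  ∏_j t/(e^{a_j t} - 1)
  prodT : ∀ {r} → Vec Carrier r → PS
  prodT [] = oneS
  prodT (a ∷ as) = mulS (tOverExpm1 a) (prodT as)

  uS : PS
  uS n = oneS n - expS (- 1#) n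

  invPowInt : ℤ → ℕ → Carrier
  invPowInt (+ n) m = (pow (ofℕ (suc m)) n) ⁻¹
  invPowInt -[1+ n ] m = pow (ofℕ (suc m)) (suc n)

  -- Li_k(u)/u = Σ_{m≥1} u^{m-1}/m^k = Σ_{m≥0} u^m/(m+1)^k with u = 1 - e^{-t}.
  -- Since u has zero constant term, u^m contributes to [t^n] only for m ≤ n,
  -- so the n-th coefficient is the finite sum below.
  liOverU : ℤ → PS
  liOverU k n = sumTo n (λ m → powS uS m n * invPowInt k m)

  genS : ∀ {r} → ℤ → Carrier → Vec Carrier r → PS
  genS k x a = mulS (mulS (prodT a) (liOverU k)) (expS x)

  S : ℕ → ∀ {r} → ℤ → Carrier → Vec Carrier r → Carrier
  S n k x a = ofℕ (n !) * genS k x a n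

  -- ordinary Bernoulli numbers: t/(e^t - 1) = Σ B_n t^n / n!
  B : ℕ → Carrier
  B n = ofℕ (n !) * tOverExpm1 1# n

  binom : ℕ → ℕ → Carrier
  binom n l = ofℕ (n C l)

{-# OPTIONS --safe #-}
-- Write the generating function as G = P · L · E with P = ∏ⱼ t/(e^{aⱼt} − 1), L = Li_k(u)/u
-- for u = 1 − e^{−t}, and E = e^{xt}, and apply the Euler operator θ = t d/dt, which multiplies
-- the coefficient of tⁿ by n. Each factor has a simple logarithmic θ-derivative: θE = xtE;
-- θ(t/(e^{bt} − 1)) = (1 − γ_b) · t/(e^{bt} − 1) with γ_b = −bt/(e^{−bt} − 1); and, because
-- θu = βu for β = t/(e^t − 1), θL_k = β (L_{k−1} − L_k). Since P β is the product for the
-- parameters (a, 1), this gives θG = Σⱼ (1 − γ_{aⱼ}) G − (G_{(a,1),k} − G_{(a,1),k−1}) + xtG, and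
-- comparing coefficients of t^{n+1} gives the recurrence, with (−b)^m B_m / m! = [t^m] γ_b.
module Submission where

open import Defs
open import Data.Nat using (ℕ; suc; _∸_; _<_)
open import Data.Integer using (ℤ; _-_; +_)
open import Data.Vec using (Vec; lookup; _∷ʳ_)
open import Relation.Nullary using (¬_)

open import Algebra.Bundles using (CommutativeRing)
open import Algebra.Solver.Ring.AlmostCommutativeRing as AC using (_-Raw-AlmostCommutative⟶_)
import Algebra.Solver.Ring as RingSolver
open import Data.Fin using () renaming (zero to fzero; suc to fsuc)
open import Data.Integer using (-[1+_])
import Data.Integer as Int
import Data.Integer.Properties as IntP
open import Data.Maybe using (Maybe; just; nothing)
open import Data.Nat using (zero; _≤_; z≤n; s≤s; _!) renaming (_+_ to _+ℕ_; _*_ to _*ℕ_)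
open import Data.Nat.Combinatorics using (_C_; nCk≡n!/k![n-k]!; k![n∸k]!∣n!)
open import Data.Nat.DivMod using (m/n*n≡m)
import Data.Nat.Properties as NP
open import Data.Product using (_,_)
open import Data.Sign as Sign using (Sign)
open import Data.Sum using (inj₁; inj₂)
open import Data.Vec using ([]; _∷_)
open import Relation.Binary.PropositionalEquality as P using (_≡_)
import Relation.Binary.Reasoning.Setoid as SetoidReasoning
open import Relation.Nullary using (yes; no)

module IntegerCoefficients {c ℓ} (R : CommutativeRing c ℓ) where
  open CommutativeRing R
  open import Algebra.Properties.Ring ring
  open import Algebra.Properties.Semiring.Mult semiring using (_×_; ×-homo-+; ×1-homo-*)
  open import Algebra.Properties.CommutativeSemigroup *-commutativeSemigroup using (interchange)
  open SetoidReasoning setoid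

  ⟦_⟧ℤ : ℤ → Carrier
  ⟦ + n ⟧ℤ = n × 1#
  ⟦ -[1+ n ] ⟧ℤ = - (suc n × 1#)

  ⟦_⟧± : Sign → Carrier
  ⟦ Sign.+ ⟧± = 1#
  ⟦ Sign.- ⟧± = - 1#

  ⟦⟧ℤ-homo-neg : ∀ i → ⟦ Int.- i ⟧ℤ ≈ - ⟦ i ⟧ℤ
  ⟦⟧ℤ-homo-neg -[1+ n ] = sym (-‿involutive _)
  ⟦⟧ℤ-homo-neg (+ zero) = sym -0#≈0#
  ⟦⟧ℤ-homo-neg (+ suc n) = refl

  ×-homo-∸ : ∀ {m n} → n ≤ m → (m ∸ n) × 1# ≈ m × 1# + - (n × 1#)
  ×-homo-∸ {m} {n} n≤m = begin
    (m ∸ n) × 1#                              ≈⟨ sym (+-identityʳ _) ⟩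
    (m ∸ n) × 1# + 0#                         ≈⟨ +-cong refl (sym (-‿inverseʳ (n × 1#))) ⟩
    (m ∸ n) × 1# + (n × 1# + - (n × 1#))      ≈⟨ sym (+-assoc _ _ _) ⟩
    ((m ∸ n) × 1# + n × 1#) + - (n × 1#)      ≈⟨ +-cong (sym (×-homo-+ 1# (m ∸ n) n)) refl ⟩
    ((m ∸ n) +ℕ n) × 1# + - (n × 1#)         ≡⟨ P.cong (λ p → p × 1# + - (n × 1#)) (NP.m∸n+n≡m n≤m) ⟩
    m × 1# + - (n × 1#)                         ∎

  ⟦⟧ℤ-homo-⊖ : ∀ m n → ⟦ m Int.⊖ n ⟧ℤ ≈ m × 1# + - (n × 1#)
  ⟦⟧ℤ-homo-⊖ m n with NP.≤-total n m
  ... | inj₁ n≤m rewrite IntP.⊖-≥ n≤m = ×-homo-∸ n≤m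
  ... | inj₂ m≤n rewrite IntP.⊖-≤ m≤n = begin
    ⟦ Int.- (+ (n ∸ m)) ⟧ℤ         ≈⟨ ⟦⟧ℤ-homo-neg (+ (n ∸ m)) ⟩
    - ((n ∸ m) × 1#)             ≈⟨ -‿cong (×-homo-∸ m≤n) ⟩
    - (n × 1# + - (m × 1#))        ≈⟨ sym (-‿+-comm _ _) ⟩
    - (n × 1#) + - (- (m × 1#))    ≈⟨ +-cong refl (-‿involutive _) ⟩
    - (n × 1#) + m × 1#            ≈⟨ +-comm _ _ ⟩
    m × 1# + - (n × 1#)            ∎

  ⟦⟧ℤ-homo-+ : ∀ i j → ⟦ i Int.+ j ⟧ℤ ≈ ⟦ i ⟧ℤ + ⟦ j ⟧ℤ
  ⟦⟧ℤ-homo-+ -[1+ m ] -[1+ n ] = begin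
    - (suc (suc (m +ℕ n)) × 1#)         ≡⟨ P.cong (λ p → - (suc p × 1#)) (NP.+-suc m n) ⟨
    - ((suc m +ℕ suc n) × 1#)           ≈⟨ -‿cong (×-homo-+ 1# (suc m) (suc n)) ⟩
    - (suc m × 1# + suc n × 1#)          ≈⟨ sym (-‿+-comm _ _) ⟩
    - (suc m × 1#) + - (suc n × 1#)      ∎
  ⟦⟧ℤ-homo-+ -[1+ m ] (+ n) = trans (⟦⟧ℤ-homo-⊖ n (suc m)) (+-comm _ _)
  ⟦⟧ℤ-homo-+ (+ m) -[1+ n ] = ⟦⟧ℤ-homo-⊖ m (suc n)
  ⟦⟧ℤ-homo-+ (+ m) (+ n) = ×-homo-+ 1# m n

  ⟦◃⟧ : ∀ s n → ⟦ s Int.◃ n ⟧ℤ ≈ ⟦ s ⟧± * n × 1#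
  ⟦◃⟧ s zero = sym (zeroʳ _)
  ⟦◃⟧ Sign.+ (suc n) = sym (*-identityˡ _)
  ⟦◃⟧ Sign.- (suc n) = sym (-1*x≈-x _)

  ⟦⟧ℤ-sign-abs : ∀ i → ⟦ i ⟧ℤ ≈ ⟦ Int.sign i ⟧± * Int.∣ i ∣ × 1#
  ⟦⟧ℤ-sign-abs i = trans (reflexive (P.cong ⟦_⟧ℤ (P.sym (IntP.◃-inverse i)))) (⟦◃⟧ (Int.sign i) Int.∣ i ∣)

  ⟦⟧±-homo-* : ∀ s t → ⟦ s Sign.* t ⟧± ≈ ⟦ s ⟧± * ⟦ t ⟧±
  ⟦⟧±-homo-* Sign.+ t = sym (*-identityˡ _)
  ⟦⟧±-homo-* Sign.- Sign.+ = sym (*-identityʳ _)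
  ⟦⟧±-homo-* Sign.- Sign.- = sym (trans (-1*x≈-x _) (-‿involutive 1#))

  ⟦⟧ℤ-homo-* : ∀ i j → ⟦ i Int.* j ⟧ℤ ≈ ⟦ i ⟧ℤ * ⟦ j ⟧ℤ
  ⟦⟧ℤ-homo-* i j = begin
    ⟦ sign i Sign.* sign j Int.◃ ∣ i ∣ *ℕ ∣ j ∣ ⟧ℤ             ≈⟨ ⟦◃⟧ (sign i Sign.* sign j) (∣ i ∣ *ℕ ∣ j ∣) ⟩
    ⟦ sign i Sign.* sign j ⟧± * (∣ i ∣ *ℕ ∣ j ∣) × 1#      ≈⟨ *-cong (⟦⟧±-homo-* (sign i) (sign j)) (×1-homo-* ∣ i ∣ ∣ j ∣) ⟩
    (⟦ sign i ⟧± * ⟦ sign j ⟧±) * (∣ i ∣ × 1# * ∣ j ∣ × 1#) ≈⟨ interchange _ _ _ _ ⟩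
    (⟦ sign i ⟧± * ∣ i ∣ × 1#) * (⟦ sign j ⟧± * ∣ j ∣ × 1#) ≈⟨ sym (*-cong (⟦⟧ℤ-sign-abs i) (⟦⟧ℤ-sign-abs j)) ⟩
    ⟦ i ⟧ℤ * ⟦ j ⟧ℤ                                       ∎
    where
    open Int using (sign; ∣_∣)

  homomorphism : Int.+-*-rawRing -Raw-AlmostCommutative⟶ AC.fromCommutativeRing R
  homomorphism = record
    { ⟦_⟧ = ⟦_⟧ℤ ; +-homo = ⟦⟧ℤ-homo-+ ; *-homo = ⟦⟧ℤ-homo-* ; -‿homo = ⟦⟧ℤ-homo-neg
    ; 0-homo = refl ; 1-homo = +-identityʳ 1# }

  equal? : ∀ i j → Maybe (⟦ i ⟧ℤ ≈ ⟦ j ⟧ℤ)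
  equal? i j with i Int.≟ j
  ... | yes P.refl = just refl
  ... | no _ = nothing

  open RingSolver Int.+-*-rawRing (AC.fromCommutativeRing R) homomorphism equal? public

nCk*[k!*[n∸k]!]≡n! : ∀ {n k} → k ≤ n → (n C k) *ℕ (k ! *ℕ (n ∸ k) !) ≡ n !
nCk*[k!*[n∸k]!]≡n! {n} {k} k≤n = P.trans
  (P.cong (_*ℕ (k ! *ℕ (n ∸ k) !)) (nCk≡n!/k![n-k]! k≤n))
  (m/n*n≡m {{NP._!*_!≢0 k (n ∸ k)}} (k![n∸k]!∣n! k≤n))

module Properties {c ℓ} (F : CharZeroField c ℓ) where
  open CharZeroField F hiding (_-_)
  open Series F
  open import Algebra.Properties.Ring ring using (-‿involutive; -0#≈0#; -‿+-comm)
  open import Algebra.Properties.Semiring.Mult semiring using (_×_; ×-homo-+; ×1-homo-*)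
  open IntegerCoefficients commRing using (solve; _:+_; _:*_; :-_; _:=_)
  open SetoidReasoning setoid

  ⁻¹-inverseˡ : ∀ {x} → ¬ x ≈ 0# → x ⁻¹ * x ≈ 1#
  ⁻¹-inverseˡ {x} x≉0 = trans (*-comm _ _) (⁻¹-inverse x x≉0)

  *-cancelˡ-≉0 : ∀ {z x y} → ¬ z ≈ 0# → z * x ≈ z * y → x ≈ y
  *-cancelˡ-≉0 {z} {x} {y} z≉0 zx≈zy = begin
    x                  ≈⟨ sym (*-identityˡ x) ⟩
    1# * x             ≈⟨ *-cong (sym (⁻¹-inverseˡ z≉0)) refl ⟩
    (z ⁻¹ * z) * x     ≈⟨ *-assoc _ _ _ ⟩
    z ⁻¹ * (z * x)     ≈⟨ *-cong refl zx≈zy ⟩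
    z ⁻¹ * (z * y)     ≈⟨ sym (*-assoc _ _ _) ⟩
    (z ⁻¹ * z) * y     ≈⟨ *-cong (⁻¹-inverseˡ z≉0) refl ⟩
    1# * y             ≈⟨ *-identityˡ y ⟩
    y                  ∎

  *-≉0 : ∀ {x y} → ¬ x ≈ 0# → ¬ y ≈ 0# → ¬ x * y ≈ 0#
  *-≉0 {x} x≉0 y≉0 xy≈0 = y≉0 (*-cancelˡ-≉0 x≉0 (trans xy≈0 (sym (zeroʳ x))))

  -‿≉0 : ∀ {x} → ¬ x ≈ 0# → ¬ - x ≈ 0#
  -‿≉0 {x} x≉0 -x≈0 = x≉0 (trans (sym (-‿involutive x)) (trans (-‿cong -x≈0) -0#≈0#))

  ⁻¹-cong : ∀ {x y} → ¬ x ≈ 0# → x ≈ y → x ⁻¹ ≈ y ⁻¹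
  ⁻¹-cong {x} {y} x≉0 x≈y = *-cancelˡ-≉0 y≉0 (begin
    y * x ⁻¹   ≈⟨ *-cong (sym x≈y) refl ⟩
    x * x ⁻¹   ≈⟨ ⁻¹-inverse x x≉0 ⟩
    1#         ≈⟨ sym (⁻¹-inverse y y≉0) ⟩
    y * y ⁻¹   ∎)
    where
    y≉0 : ¬ y ≈ 0#
    y≉0 y≈0 = x≉0 (trans x≈y y≈0)

  ⁻¹-distrib-* : ∀ {x y} → ¬ x ≈ 0# → ¬ y ≈ 0# → (x * y) ⁻¹ ≈ x ⁻¹ * y ⁻¹
  ⁻¹-distrib-* {x} {y} x≉0 y≉0 = *-cancelˡ-≉0 (*-≉0 x≉0 y≉0) (begin
    (x * y) * (x * y) ⁻¹       ≈⟨ ⁻¹-inverse _ (*-≉0 x≉0 y≉0) ⟩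
    1#                         ≈⟨ sym (*-identityˡ 1#) ⟩
    1# * 1#                    ≈⟨ sym (*-cong (⁻¹-inverse x x≉0) (⁻¹-inverse y y≉0)) ⟩
    (x * x ⁻¹) * (y * y ⁻¹)    ≈⟨ solve 4 (λ a b c d → ((a :* c) :* (b :* d)) := ((a :* b) :* (c :* d))) refl x y (x ⁻¹) (y ⁻¹) ⟩
    (x * y) * (x ⁻¹ * y ⁻¹)    ∎)

  1⁻¹≈1 : 1# ⁻¹ ≈ 1#
  1⁻¹≈1 = *-cancelˡ-≉0 1≉0 (trans (⁻¹-inverse 1# 1≉0) (sym (*-identityˡ 1#)))

  ofℕ≈×1 : ∀ n → ofℕ n ≈ n × 1#
  ofℕ≈×1 zero = refl
  ofℕ≈×1 (suc n) = +-cong refl (ofℕ≈×1 n)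

  ofℕ-+ : ∀ m n → ofℕ (m +ℕ n) ≈ ofℕ m + ofℕ n
  ofℕ-+ m n = trans (ofℕ≈×1 (m +ℕ n)) (trans (×-homo-+ 1# m n) (sym (+-cong (ofℕ≈×1 m) (ofℕ≈×1 n))))

  ofℕ-* : ∀ m n → ofℕ (m *ℕ n) ≈ ofℕ m * ofℕ n
  ofℕ-* m n = trans (ofℕ≈×1 (m *ℕ n)) (trans (×1-homo-* m n) (sym (*-cong (ofℕ≈×1 m) (ofℕ≈×1 n))))

  ofℕ-!≉0 : ∀ n → ¬ ofℕ (n !) ≈ 0#
  ofℕ-!≉0 zero = charZero 0
  ofℕ-!≉0 (suc n) e = *-≉0 (charZero n) (ofℕ-!≉0 n) (trans (sym (ofℕ-* (suc n) (n !))) e)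

  invFact-0 : invFact 0 ≈ 1#
  invFact-0 = trans (⁻¹-cong (charZero 0) (+-identityʳ 1#)) 1⁻¹≈1

  [1+n]*invFact[1+n]≈invFact[n] : ∀ n → ofℕ (suc n) * invFact (suc n) ≈ invFact n
  [1+n]*invFact[1+n]≈invFact[n] n = begin
    N * ofℕ (suc n *ℕ n !) ⁻¹     ≈⟨ *-cong refl (⁻¹-cong (ofℕ-!≉0 (suc n)) (ofℕ-* (suc n) (n !))) ⟩
    N * (N * ofℕ (n !)) ⁻¹        ≈⟨ *-cong refl (⁻¹-distrib-* (charZero n) (ofℕ-!≉0 n)) ⟩
    N * (N ⁻¹ * invFact n)        ≈⟨ sym (*-assoc _ _ _) ⟩
    (N * N ⁻¹) * invFact n        ≈⟨ *-cong (⁻¹-inverse N (charZero n)) refl ⟩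
    1# * invFact n                ≈⟨ *-identityˡ _ ⟩
    invFact n                     ∎
    where
    N : Carrier
    N = ofℕ (suc n)

  pow-+ : ∀ z i j → pow z (i +ℕ j) ≈ pow z i * pow z j
  pow-+ z zero j = sym (*-identityˡ _)
  pow-+ z (suc i) j = trans (*-cong refl (pow-+ z i j)) (sym (*-assoc _ _ _))

  pow-cong : ∀ {x y} k → x ≈ y → pow x k ≈ pow y k
  pow-cong zero x≈y = refl
  pow-cong (suc k) x≈y = *-cong x≈y (pow-cong k x≈y)

  pow-1# : ∀ k → pow 1# k ≈ 1#
  pow-1# zero = refl
  pow-1# (suc k) = trans (*-identityˡ _) (pow-1# k)

  pow-≉0 : ∀ {x} k → ¬ x ≈ 0# → ¬ pow x k ≈ 0#
  pow-≉0 zero x≉0 = 1≉0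
  pow-≉0 (suc k) x≉0 = *-≉0 x≉0 (pow-≉0 k x≉0)

  sumTo-cong-≤ : ∀ n {f g : ℕ → Carrier} → (∀ i → i ≤ n → f i ≈ g i) → sumTo n f ≈ sumTo n g
  sumTo-cong-≤ zero f≈g = f≈g 0 z≤n
  sumTo-cong-≤ (suc n) f≈g = +-cong (sumTo-cong-≤ n (λ i i≤n → f≈g i (NP.m≤n⇒m≤1+n i≤n))) (f≈g (suc n) NP.≤-refl)

  sumTo-cong : ∀ n {f g : ℕ → Carrier} → (∀ i → f i ≈ g i) → sumTo n f ≈ sumTo n g
  sumTo-cong n f≈g = sumTo-cong-≤ n (λ i _ → f≈g i)

  sumTo-≈0 : ∀ n f → (∀ i → i ≤ n → f i ≈ 0#) → sumTo n f ≈ 0#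
  sumTo-≈0 zero f f≈0 = f≈0 0 z≤n
  sumTo-≈0 (suc n) f f≈0 = trans
    (+-cong (sumTo-≈0 n f (λ i i≤n → f≈0 i (NP.m≤n⇒m≤1+n i≤n))) (f≈0 (suc n) NP.≤-refl))
    (+-identityˡ 0#)

  sumTo-sucˡ : ∀ n f → sumTo (suc n) f ≈ f 0 + sumTo n (λ i → f (suc i))
  sumTo-sucˡ zero f = refl
  sumTo-sucˡ (suc n) f = trans (+-cong (sumTo-sucˡ n f) refl) (+-assoc _ _ _)

  sumTo-+ : ∀ n f g → sumTo n (λ i → f i + g i) ≈ sumTo n f + sumTo n g
  sumTo-+ zero f g = refl
  sumTo-+ (suc n) f g = trans (+-cong (sumTo-+ n f g) refl)
    (solve 4 (λ a b c d → ((a :+ b) :+ (c :+ d)) := ((a :+ c) :+ (b :+ d))) refl _ _ _ _)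

  sumTo-*ˡ : ∀ n z f → z * sumTo n f ≈ sumTo n (λ i → z * f i)
  sumTo-*ˡ zero z f = refl
  sumTo-*ˡ (suc n) z f = trans (distribˡ _ _ _) (+-cong (sumTo-*ˡ n z f) refl)

  sumTo-*ʳ : ∀ n z f → sumTo n f * z ≈ sumTo n (λ i → f i * z)
  sumTo-*ʳ n z f = trans (*-comm _ _) (trans (sumTo-*ˡ n z f) (sumTo-cong n (λ i → *-comm _ _)))

  sumTo-neg : ∀ n f → - sumTo n f ≈ sumTo n (λ i → - f i)
  sumTo-neg zero f = refl
  sumTo-neg (suc n) f = trans (sym (-‿+-comm _ _)) (+-cong (sumTo-neg n f) refl)

  sumTo-reverse : ∀ n f → sumTo n f ≈ sumTo n (λ i → f (n ∸ i))
  sumTo-reverse zero f = refl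
  sumTo-reverse (suc n) f = begin
    sumTo (suc n) f                          ≈⟨ sumTo-sucˡ n f ⟩
    f 0 + sumTo n (λ i → f (suc i))          ≈⟨ +-cong refl (sumTo-reverse n (λ i → f (suc i))) ⟩
    f 0 + sumTo n (λ i → f (suc (n ∸ i)))    ≈⟨ +-comm _ _ ⟩
    sumTo n (λ i → f (suc (n ∸ i))) + f 0    ≈⟨ +-cong (sumTo-cong-≤ n (λ i i≤n → reflexive (P.cong f (P.sym (NP.+-∸-assoc 1 i≤n)))))
                                                       (reflexive (P.cong f (P.sym (NP.n∸n≡0 n)))) ⟩
    sumTo (suc n) (λ i → f (suc n ∸ i))      ∎

  sumTo-swap : ∀ n m (A : ℕ → ℕ → Carrier) →
    sumTo n (λ i → sumTo m (λ j → A i j)) ≈ sumTo m (λ j → sumTo n (λ i → A i j))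
  sumTo-swap zero m A = refl
  sumTo-swap (suc n) m A = trans (+-cong (sumTo-swap n m A) refl) (sym (sumTo-+ m _ _))

  sumTo-truncate : ∀ j N f → j ≤ N → (∀ m → j < m → m ≤ N → f m ≈ 0#) → sumTo N f ≈ sumTo j f
  sumTo-truncate j zero f z≤n _ = refl
  sumTo-truncate j (suc N) f j≤1+N f≈0 with NP.m≤n⇒m<n∨m≡n j≤1+N
  ... | inj₂ P.refl = refl
  ... | inj₁ (s≤s j≤N) = trans
    (+-cong (sumTo-truncate j N f j≤N (λ m j<m m≤N → f≈0 m j<m (NP.m≤n⇒m≤1+n m≤N))) (f≈0 (suc N) (s≤s j≤N) NP.≤-refl))
    (+-identityʳ _)

  sumVec-cong : ∀ {r} (a : Vec Carrier r) {f g : Carrier → Carrier} → (∀ b → f b ≈ g b) → sumVec a f ≈ sumVec a g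
  sumVec-cong [] f≈g = refl
  sumVec-cong (b ∷ a) f≈g = +-cong (f≈g b) (sumVec-cong a f≈g)

  sumVec-*ˡ : ∀ {r} (a : Vec Carrier r) z f → z * sumVec a f ≈ sumVec a (λ b → z * f b)
  sumVec-*ˡ [] z f = zeroʳ z
  sumVec-*ˡ (b ∷ a) z f = trans (distribˡ _ _ _) (+-cong refl (sumVec-*ˡ a z f))

  -- The ring of formal power series

  infix 4 _≋_
  _≋_ : PS → PS → Set ℓ
  f ≋ g = ∀ n → f n ≈ g n

  infixl 6 _+ₛ_
  _+ₛ_ : PS → PS → PS
  (f +ₛ g) n = f n + g n

  -ₛ_ : PS → PS
  (-ₛ f) n = - f n

  0ₛ : PS
  0ₛ n = 0#

  shift : PS → PS
  shift f n = f (suc n)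

  mulS-cong : ∀ {f f′ g g′} → f ≋ f′ → g ≋ g′ → mulS f g ≋ mulS f′ g′
  mulS-cong f≋f′ g≋g′ n = sumTo-cong n (λ i → *-cong (f≋f′ i) (g≋g′ (n ∸ i)))

  mulS-suc : ∀ f g n → mulS f g (suc n) ≈ f 0 * g (suc n) + mulS (shift f) g n
  mulS-suc f g n = sumTo-sucˡ n _

  mulS-comm : ∀ f g → mulS f g ≋ mulS g f
  mulS-comm f g n = trans (sumTo-reverse n _)
    (sumTo-cong-≤ n (λ i i≤n → trans (*-comm _ _) (*-cong (reflexive (P.cong g (NP.m∸[m∸n]≡n i≤n))) refl)))

  mulS-distribʳ : ∀ f g h → mulS (f +ₛ g) h ≋ mulS f h +ₛ mulS g h
  mulS-distribʳ f g h n = trans (sumTo-cong n (λ i → distribʳ _ _ _)) (sumTo-+ n _ _)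

  mulS-distribˡ : ∀ f g h → mulS h (f +ₛ g) ≋ mulS h f +ₛ mulS h g
  mulS-distribˡ f g h n = trans (sumTo-cong n (λ i → distribˡ _ _ _)) (sumTo-+ n _ _)

  mulS-zeroˡ : ∀ g → mulS 0ₛ g ≋ 0ₛ
  mulS-zeroˡ g n = sumTo-≈0 n _ (λ i _ → zeroˡ _)

  mulS-identityˡ : ∀ f → mulS oneS f ≋ f
  mulS-identityˡ f zero = *-identityˡ _
  mulS-identityˡ f (suc n) = trans (mulS-suc oneS f n)
    (trans (+-cong (*-identityˡ _) (mulS-zeroˡ f n)) (+-identityʳ _))

  mulS-assoc : ∀ f g h → mulS (mulS f g) h ≋ mulS f (mulS g h)
  mulS-assoc f g h zero = *-assoc _ _ _
  mulS-assoc f g h (suc n) = begin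
    mulS (mulS f g) h (suc n)                                     ≈⟨ mulS-suc (mulS f g) h n ⟩
    (f 0 * g 0) * h (suc n) + mulS (shift (mulS f g)) h n         ≈⟨ +-cong refl shift-mulS-assoc ⟩
    (f 0 * g 0) * h (suc n) + (f 0 * mulS (shift g) h n + mulS (shift f) (mulS g h) n)
      ≈⟨ solve 5 (λ a b H X Y → (((a :* b) :* H) :+ ((a :* X) :+ Y)) := ((a :* ((b :* H) :+ X)) :+ Y)) refl _ _ _ _ _ ⟩
    f 0 * (g 0 * h (suc n) + mulS (shift g) h n) + mulS (shift f) (mulS g h) n
                                                                  ≈⟨ +-cong (*-cong refl (sym (mulS-suc g h n))) refl ⟩
    f 0 * mulS g h (suc n) + mulS (shift f) (mulS g h) n          ≈⟨ sym (mulS-suc f (mulS g h) n) ⟩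
    mulS f (mulS g h) (suc n)                                     ∎
    where
    shift-mulS-assoc : mulS (shift (mulS f g)) h n ≈ f 0 * mulS (shift g) h n + mulS (shift f) (mulS g h) n
    shift-mulS-assoc = begin
      mulS (shift (mulS f g)) h n                                 ≈⟨ mulS-cong {g = h} (mulS-suc f g) (λ _ → refl) n ⟩
      mulS ((λ m → f 0 * g (suc m)) +ₛ mulS (shift f) g) h n      ≈⟨ mulS-distribʳ _ _ h n ⟩
      mulS (λ m → f 0 * g (suc m)) h n + mulS (mulS (shift f) g) h n
                                                                  ≈⟨ +-cong (trans (sumTo-cong n (λ i → *-assoc _ _ _)) (sym (sumTo-*ˡ n (f 0) _)))
                                                                            (mulS-assoc (shift f) g h n) ⟩
      f 0 * mulS (shift g) h n + mulS (shift f) (mulS g h) n      ∎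

  powerSeriesRing : CommutativeRing c ℓ
  powerSeriesRing = record
    { Carrier = PS ; _≈_ = _≋_ ; _+_ = _+ₛ_ ; _*_ = mulS ; -_ = -ₛ_ ; 0# = 0ₛ ; 1# = oneS
    ; isCommutativeRing = record
      { isRing = record
        { +-isAbelianGroup = record
          { isGroup = record
            { isMonoid = record
              { isSemigroup = record
                { isMagma = record
                  { isEquivalence = record
                    { refl = λ n → refl ; sym = λ f≋g n → sym (f≋g n) ; trans = λ f≋g g≋h n → trans (f≋g n) (g≋h n) }
                  ; ∙-cong = λ f≋f′ g≋g′ n → +-cong (f≋f′ n) (g≋g′ n) }
                ; assoc = λ f g h n → +-assoc (f n) (g n) (h n) }
              ; identity = (λ f n → +-identityˡ (f n)) , (λ f n → +-identityʳ (f n)) }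
            ; inverse = (λ f n → -‿inverseˡ (f n)) , (λ f n → -‿inverseʳ (f n))
            ; ⁻¹-cong = λ f≋g n → -‿cong (f≋g n) }
          ; comm = λ f g n → +-comm (f n) (g n) }
        ; *-cong = mulS-cong
        ; *-assoc = mulS-assoc
        ; *-identity = mulS-identityˡ , (λ f n → trans (mulS-comm f oneS n) (mulS-identityˡ f n))
        ; distrib = (λ h f g → mulS-distribˡ f g h) , (λ h f g → mulS-distribʳ f g h) }
      ; *-comm = mulS-comm } }

  open CommutativeRing powerSeriesRing using ()
    renaming (refl to ≋-refl; sym to ≋-sym; trans to ≋-trans; +-cong to +ₛ-cong; -‿cong to -ₛ-cong; +-identityˡ to +ₛ-identityˡ
             ; *-identityʳ to mulS-identityʳ; zeroʳ to mulS-zeroʳ)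
  open IntegerCoefficients powerSeriesRing using ()
    renaming (solve to solveₛ; _:+_ to _⊕_; _:*_ to _⊗_; :-_ to ⊝_; _:=_ to _⊜_)

  infixr 2 _≋⟨_⟩_
  infix 3 _∎ₛ
  infix 1 beginₛ_
  beginₛ_ : ∀ {f g} → f ≋ g → f ≋ g
  beginₛ f≋g = f≋g
  _≋⟨_⟩_ : ∀ f {g h} → f ≋ g → g ≋ h → f ≋ h
  f ≋⟨ f≋g ⟩ g≋h = λ n → trans (f≋g n) (g≋h n)
  _∎ₛ : ∀ f → f ≋ f
  f ∎ₛ = ≋-refl

  mulS-congˡ : ∀ {f f′} g → f ≋ f′ → mulS f g ≋ mulS f′ g
  mulS-congˡ g f≋f′ = mulS-cong {g = g} f≋f′ ≋-refl

  mulS-congʳ : ∀ f {g g′} → g ≋ g′ → mulS f g ≋ mulS f g′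
  mulS-congʳ f g≋g′ = mulS-cong {f = f} ≋-refl g≋g′

  -- The Euler operator θ = t d/dt

  θ : PS → PS
  θ f n = ofℕ n * f n

  θ-cong : ∀ {f g} → f ≋ g → θ f ≋ θ g
  θ-cong f≋g n = *-cong refl (f≋g n)

  θ-+ : ∀ f g → θ (f +ₛ g) ≋ θ f +ₛ θ g
  θ-+ f g n = distribˡ _ _ _

  θ-neg : ∀ f → θ (-ₛ f) ≋ -ₛ θ f
  θ-neg f n = solve 2 (λ a b → (a :* (:- b)) := (:- (a :* b))) refl _ _

  θ-oneS : θ oneS ≋ 0ₛ
  θ-oneS zero = zeroˡ _
  θ-oneS (suc n) = zeroʳ _

  θ-mulS : ∀ f g → θ (mulS f g) ≋ mulS (θ f) g +ₛ mulS f (θ g)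
  θ-mulS f g n = begin
    ofℕ n * sumTo n (λ i → f i * g (n ∸ i))      ≈⟨ sumTo-*ˡ n _ _ ⟩
    sumTo n (λ i → ofℕ n * (f i * g (n ∸ i)))    ≈⟨ sumTo-cong-≤ n leibniz ⟩
    sumTo n (λ i → (ofℕ i * f i) * g (n ∸ i) + f i * (ofℕ (n ∸ i) * g (n ∸ i)))
                                                 ≈⟨ sumTo-+ n _ _ ⟩
    mulS (θ f) g n + mulS f (θ g) n              ∎
    where
    leibniz : ∀ i → i ≤ n → ofℕ n * (f i * g (n ∸ i)) ≈ (ofℕ i * f i) * g (n ∸ i) + f i * (ofℕ (n ∸ i) * g (n ∸ i))
    leibniz i i≤n = begin
      ofℕ n * (f i * g (n ∸ i))                  ≡⟨ P.cong (λ m → ofℕ m * (f i * g (n ∸ i))) (NP.m+[n∸m]≡n i≤n) ⟨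
      ofℕ (i +ℕ (n ∸ i)) * (f i * g (n ∸ i))     ≈⟨ *-cong (ofℕ-+ i (n ∸ i)) refl ⟩
      (ofℕ i + ofℕ (n ∸ i)) * (f i * g (n ∸ i))
        ≈⟨ solve 4 (λ a b x y → ((a :+ b) :* (x :* y)) := (((a :* x) :* y) :+ (x :* (b :* y)))) refl _ _ _ _ ⟩
      (ofℕ i * f i) * g (n ∸ i) + f i * (ofℕ (n ∸ i) * g (n ∸ i)) ∎

  tS : PS
  tS zero = 0#
  tS (suc m) = oneS m

  mulS-tS-zero : ∀ f → mulS tS f 0 ≈ 0#
  mulS-tS-zero f = zeroˡ _

  mulS-tS-suc : ∀ f n → mulS tS f (suc n) ≈ f n
  mulS-tS-suc f n = trans (mulS-suc tS f n) (trans (+-cong (zeroˡ _) (mulS-identityˡ f n)) (+-identityˡ _))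

  mulS-tS-cancel : ∀ {f g} → mulS tS f ≋ mulS tS g → f ≋ g
  mulS-tS-cancel {f} {g} tf≋tg n = trans (sym (mulS-tS-suc f n)) (trans (tf≋tg (suc n)) (mulS-tS-suc g n))

  constS : Carrier → PS
  constS z zero = z
  constS z (suc _) = 0#

  mulS-constS : ∀ z f → mulS (constS z) f ≋ (λ n → z * f n)
  mulS-constS z f zero = refl
  mulS-constS z f (suc n) = trans (mulS-suc (constS z) f n) (trans (+-cong refl (mulS-zeroˡ f n)) (+-identityʳ _))

  constS-+ : ∀ x y → constS (x + y) ≋ constS x +ₛ constS y
  constS-+ x y zero = refl
  constS-+ x y (suc n) = sym (+-identityˡ 0#)

  constS-neg : ∀ z → constS (- z) ≋ -ₛ constS z
  constS-neg z zero = refl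
  constS-neg z (suc n) = sym -0#≈0#

  constS-1# : constS 1# ≋ oneS
  constS-1# zero = refl
  constS-1# (suc n) = refl

  constS-0# : constS 0# ≋ 0ₛ
  constS-0# zero = refl
  constS-0# (suc n) = refl

  mulS-constS-cancel : ∀ {z f g} → ¬ z ≈ 0# → mulS (constS z) f ≋ mulS (constS z) g → f ≋ g
  mulS-constS-cancel {z} {f} {g} z≉0 zf≋zg n =
    *-cancelˡ-≉0 z≉0 (trans (sym (mulS-constS z f n)) (trans (zf≋zg n) (mulS-constS z g n)))

  -- The equation θ f = z t f, i.e. f′ = z f, written coefficientwise.
  ODE : Carrier → PS → Set ℓ
  ODE z f = ∀ n → ofℕ (suc n) * f (suc n) ≈ z * f n

  ODE⇒θ : ∀ {z f} → ODE z f → θ f ≋ mulS tS (mulS (constS z) f)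
  ODE⇒θ {z} {f} ode zero = trans (zeroˡ _) (sym (mulS-tS-zero (mulS (constS z) f)))
  ODE⇒θ {z} {f} ode (suc n) = trans (ode n) (sym (trans (mulS-tS-suc (mulS (constS z) f) n) (mulS-constS z f n)))

  θ⇒ODE : ∀ {z f} → θ f ≋ mulS tS (mulS (constS z) f) → ODE z f
  θ⇒ODE {z} {f} θf≋tzf n = trans (θf≋tzf (suc n)) (trans (mulS-tS-suc (mulS (constS z) f) n) (mulS-constS z f n))

  ODE-unique : ∀ {z f g} → ODE z f → ODE z g → f 0 ≈ g 0 → f ≋ g
  ODE-unique odef odeg f₀≈g₀ zero = f₀≈g₀
  ODE-unique odef odeg f₀≈g₀ (suc n) =
    *-cancelˡ-≉0 (charZero n) (trans (odef n) (trans (*-cong refl (ODE-unique odef odeg f₀≈g₀ n)) (sym (odeg n))))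

  ODE-cong : ∀ {y z f} → y ≈ z → ODE y f → ODE z f
  ODE-cong y≈z ode n = trans (ode n) (*-cong y≈z refl)

  ODE-oneS : ODE 0# oneS
  ODE-oneS n = trans (zeroʳ _) (sym (zeroˡ _))

  ODE-mulS : ∀ {y z f g} → ODE y f → ODE z g → ODE (y + z) (mulS f g)
  ODE-mulS {y} {z} {f} {g} odef odeg = θ⇒ODE (beginₛ
    θ (mulS f g)                                              ≋⟨ θ-mulS f g ⟩
    mulS (θ f) g +ₛ mulS f (θ g)                              ≋⟨ +ₛ-cong (mulS-congˡ g (ODE⇒θ odef)) (mulS-congʳ f (ODE⇒θ odeg)) ⟩
    mulS (mulS tS (mulS (constS y) f)) g +ₛ mulS f (mulS tS (mulS (constS z) g))
      ≋⟨ solveₛ 5 (λ t Y Z f g → (((t ⊗ (Y ⊗ f)) ⊗ g) ⊕ (f ⊗ (t ⊗ (Z ⊗ g)))) ⊜ (t ⊗ ((Y ⊕ Z) ⊗ (f ⊗ g))))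
                  ≋-refl tS (constS y) (constS z) f g ⟩
    mulS tS (mulS (constS y +ₛ constS z) (mulS f g))          ≋⟨ mulS-congʳ tS (mulS-congˡ (mulS f g) (≋-sym (constS-+ y z))) ⟩
    mulS tS (mulS (constS (y + z)) (mulS f g))                ∎ₛ)

  expS-0 : ∀ z → expS z 0 ≈ 1#
  expS-0 z = trans (*-identityˡ _) invFact-0

  ODE-expS : ∀ z → ODE z (expS z)
  ODE-expS z n = begin
    ofℕ (suc n) * ((z * pow z n) * invFact (suc n))
      ≈⟨ solve 4 (λ N z p I → (N :* ((z :* p) :* I)) := (z :* (p :* (N :* I)))) refl _ _ _ _ ⟩
    z * (pow z n * (ofℕ (suc n) * invFact (suc n)))   ≈⟨ *-cong refl (*-cong refl ([1+n]*invFact[1+n]≈invFact[n] n)) ⟩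
    z * (pow z n * invFact n)                         ∎

  expS-mulS-expS-neg : ∀ z → mulS (expS z) (expS (- z)) ≋ oneS
  expS-mulS-expS-neg z = ODE-unique (ODE-cong (-‿inverseʳ z) (ODE-mulS (ODE-expS z) (ODE-expS (- z)))) ODE-oneS
    (trans (*-cong (expS-0 z) (expS-0 (- z))) (*-identityˡ 1#))

  -- Reciprocals and t/(e^{bt} − 1)

  module _ (g : PS) where
    -- The helper `dot` of Defs is private; `Dot` is that function, recovered by
    -- unification against the unfolding of `invList g (suc n)`.
    private
      mutual
        Dot : ℕ → ∀ {m} → Vec Carrier (suc m) → Carrier
        Dot = _

        invS-suc-Dot : ∀ n → invS g (suc n) ≡ - (g 0 ⁻¹ * Dot 1 (invList g n))
        invS-suc-Dot n with invList g n | 1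
        ... | v | i = P.refl {x = - (g 0 ⁻¹ * Dot i v)}

      Dot-∷ : ∀ i x {m} (v : Vec Carrier (suc m)) → Dot i (x ∷ v) ≡ g i * x + Dot (suc i) v
      Dot-∷ i x (y ∷ ys) = P.refl

      Dot-invList : ∀ m i → Dot (suc i) (invList g m) ≈ sumTo m (λ j → g (suc i +ℕ j) * invS g (m ∸ j))
      Dot-invList zero i = trans (+-identityʳ _) (*-cong (reflexive (P.cong g (P.sym (NP.+-identityʳ (suc i))))) refl)
      Dot-invList (suc m) i = begin
        Dot (suc i) (invList g (suc m))                                     ≡⟨ Dot-∷ (suc i) (invS g (suc m)) (invList g m) ⟩
        g (suc i) * invS g (suc m) + Dot (suc (suc i)) (invList g m)        ≈⟨ +-cong refl (Dot-invList m (suc i)) ⟩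
        g (suc i) * invS g (suc m) + sumTo m (λ j → g (suc (suc i) +ℕ j) * invS g (m ∸ j))
          ≈⟨ +-cong (*-cong (reflexive (P.cong g (P.sym (NP.+-identityʳ (suc i))))) refl)
                    (sumTo-cong m (λ j → *-cong (reflexive (P.cong g (P.sym (NP.+-suc (suc i) j)))) refl)) ⟩
        g (suc i +ℕ 0) * invS g (suc m ∸ 0) + sumTo m (λ j → g (suc i +ℕ suc j) * invS g (suc m ∸ suc j))
                                                                            ≈⟨ sym (sumTo-sucˡ m _) ⟩
        sumTo (suc m) (λ j → g (suc i +ℕ j) * invS g (suc m ∸ j))           ∎

    invS-suc : ∀ n → invS g (suc n) ≈ - (g 0 ⁻¹ * mulS (shift g) (invS g) n)
    invS-suc n = trans (reflexive (invS-suc-Dot n)) (-‿cong (*-cong refl (Dot-invList n 0)))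

    mulS-invS : ¬ g 0 ≈ 0# → mulS g (invS g) ≋ oneS
    mulS-invS g₀≉0 zero = ⁻¹-inverse (g 0) g₀≉0
    mulS-invS g₀≉0 (suc n) = begin
      mulS g (invS g) (suc n)                 ≈⟨ mulS-suc g (invS g) n ⟩
      g 0 * invS g (suc n) + X                ≈⟨ +-cong (*-cong refl (invS-suc n)) refl ⟩
      g 0 * (- (g 0 ⁻¹ * X)) + X              ≈⟨ solve 3 (λ a b x → ((a :* (:- (b :* x))) :+ x) := ((:- ((a :* b) :* x)) :+ x)) refl _ _ _ ⟩
      - ((g 0 * g 0 ⁻¹) * X) + X              ≈⟨ +-cong (-‿cong (*-cong (⁻¹-inverse (g 0) g₀≉0) refl)) refl ⟩
      - (1# * X) + X                          ≈⟨ +-cong (-‿cong (*-identityˡ X)) refl ⟩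
      - X + X                                 ≈⟨ -‿inverseˡ X ⟩
      0#                                      ∎
      where
      X : Carrier
      X = mulS (shift g) (invS g) n

  inverse-unique : ∀ {u w q} → mulS u q ≋ oneS → mulS w q ≋ oneS → u ≋ w
  inverse-unique {u} {w} {q} uq≋1 wq≋1 = beginₛ
    u                    ≋⟨ ≋-sym (mulS-identityʳ u) ⟩
    mulS u oneS          ≋⟨ mulS-congʳ u (≋-sym wq≋1) ⟩
    mulS u (mulS w q)    ≋⟨ solveₛ 3 (λ u w q → (u ⊗ (w ⊗ q)) ⊜ (w ⊗ (u ⊗ q))) ≋-refl u w q ⟩
    mulS w (mulS u q)    ≋⟨ mulS-congʳ w uq≋1 ⟩
    mulS w oneS          ≋⟨ mulS-identityʳ w ⟩
    w                    ∎ₛ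

  expm1DivT-0 : ∀ a → expm1DivT a 0 ≈ a
  expm1DivT-0 a = trans (*-cong (*-identityʳ a) invFact-0) (*-identityʳ a)

  expm1DivT-cong : ∀ {a b} → a ≈ b → expm1DivT a ≋ expm1DivT b
  expm1DivT-cong a≈b n = *-cong (pow-cong (suc n) a≈b) refl

  mulS-tS-expm1DivT : ∀ a → mulS tS (expm1DivT a) ≋ expS a +ₛ -ₛ oneS
  mulS-tS-expm1DivT a zero = trans (mulS-tS-zero (expm1DivT a)) (sym (trans (+-cong (expS-0 a) refl) (-‿inverseʳ 1#)))
  mulS-tS-expm1DivT a (suc n) = trans (mulS-tS-suc (expm1DivT a) n) (sym (trans (+-cong refl -0#≈0#) (+-identityʳ _)))

  expm1DivT-0≉0 : ∀ {b} → ¬ b ≈ 0# → ¬ expm1DivT b 0 ≈ 0#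
  expm1DivT-0≉0 {b} b≉0 e = b≉0 (trans (sym (expm1DivT-0 b)) e)

  mulS-tOverExpm1-expm1DivT : ∀ {b} → ¬ b ≈ 0# → mulS (tOverExpm1 b) (expm1DivT b) ≋ oneS
  mulS-tOverExpm1-expm1DivT {b} b≉0 n =
    trans (mulS-comm (tOverExpm1 b) (expm1DivT b) n) (mulS-invS (expm1DivT b) (expm1DivT-0≉0 b≉0) n)

  expS-mulS-expm1DivT-neg : ∀ b → mulS (expS b) (expm1DivT (- b)) ≋ -ₛ expm1DivT b
  expS-mulS-expm1DivT-neg b = mulS-tS-cancel (beginₛ
    mulS tS (mulS E (expm1DivT (- b)))       ≋⟨ solveₛ 3 (λ t e g → (t ⊗ (e ⊗ g)) ⊜ (e ⊗ (t ⊗ g))) ≋-refl tS E (expm1DivT (- b)) ⟩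
    mulS E (mulS tS (expm1DivT (- b)))       ≋⟨ mulS-congʳ E (mulS-tS-expm1DivT (- b)) ⟩
    mulS E (E⁻ +ₛ -ₛ oneS)                   ≋⟨ solveₛ 3 (λ e e′ o → (e ⊗ (e′ ⊕ (⊝ o))) ⊜ ((e ⊗ e′) ⊕ (⊝ (e ⊗ o)))) ≋-refl E E⁻ oneS ⟩
    mulS E E⁻ +ₛ -ₛ mulS E oneS              ≋⟨ +ₛ-cong (expS-mulS-expS-neg b) (-ₛ-cong (mulS-identityʳ E)) ⟩
    oneS +ₛ -ₛ E                             ≋⟨ solveₛ 2 (λ o e → (o ⊕ (⊝ e)) ⊜ (⊝ (e ⊕ (⊝ o)))) ≋-refl oneS E ⟩
    -ₛ (E +ₛ -ₛ oneS)                        ≋⟨ -ₛ-cong (≋-sym (mulS-tS-expm1DivT b)) ⟩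
    -ₛ mulS tS (expm1DivT b)                 ≋⟨ solveₛ 2 (λ t g → (⊝ (t ⊗ g)) ⊜ (t ⊗ (⊝ g))) ≋-refl tS (expm1DivT b) ⟩
    mulS tS (-ₛ expm1DivT b)                 ∎ₛ)
    where
    E E⁻ : PS
    E = expS b
    E⁻ = expS (- b)

  θ-expm1DivT : ∀ a → θ (expm1DivT a) ≋ mulS (constS a) (expS a) +ₛ -ₛ expm1DivT a
  θ-expm1DivT a n = begin
    ofℕ n * ((a * pow a n) * I)            ≈⟨ solve 3 (λ N p i → (N :* (p :* i)) := (p :* (N :* i))) refl _ _ _ ⟩
    (a * pow a n) * (ofℕ n * I)            ≈⟨ *-cong refl n*I≈ ⟩
    (a * pow a n) * (invFact n + - I)
      ≈⟨ solve 4 (λ a p f i → ((a :* p) :* (f :+ (:- i))) := ((a :* (p :* f)) :+ (:- ((a :* p) :* i)))) refl _ _ _ _ ⟩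
    a * (pow a n * invFact n) + - ((a * pow a n) * I)   ≈⟨ +-cong (sym (mulS-constS a (expS a) n)) refl ⟩
    mulS (constS a) (expS a) n + - expm1DivT a n        ∎
    where
    I : Carrier
    I = invFact (suc n)
    n*I≈ : ofℕ n * I ≈ invFact n + - I
    n*I≈ = begin
      ofℕ n * I                         ≈⟨ solve 3 (λ o N i → (N :* i) := (((o :+ N) :* i) :+ (:- (o :* i)))) refl 1# (ofℕ n) I ⟩
      (1# + ofℕ n) * I + - (1# * I)     ≈⟨ +-cong ([1+n]*invFact[1+n]≈invFact[n] n) (-‿cong (*-identityˡ I)) ⟩
      invFact n + - I                   ∎

  scaleS : Carrier → PS → PS
  scaleS z f m = pow z m * f m

  scaleS-cong : ∀ z {f g} → f ≋ g → scaleS z f ≋ scaleS z g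
  scaleS-cong z f≋g n = *-cong refl (f≋g n)

  scaleS-oneS : ∀ z → scaleS z oneS ≋ oneS
  scaleS-oneS z zero = *-identityˡ 1#
  scaleS-oneS z (suc n) = zeroʳ _

  scaleS-mulS : ∀ z f g → mulS (scaleS z f) (scaleS z g) ≋ scaleS z (mulS f g)
  scaleS-mulS z f g n = begin
    sumTo n (λ i → (pow z i * f i) * (pow z (n ∸ i) * g (n ∸ i)))   ≈⟨ sumTo-cong-≤ n pow-split ⟩
    sumTo n (λ i → pow z n * (f i * g (n ∸ i)))                      ≈⟨ sym (sumTo-*ˡ n _ _) ⟩
    pow z n * mulS f g n                                             ∎
    where
    pow-split : ∀ i → i ≤ n → (pow z i * f i) * (pow z (n ∸ i) * g (n ∸ i)) ≈ pow z n * (f i * g (n ∸ i))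
    pow-split i i≤n = begin
      (pow z i * f i) * (pow z (n ∸ i) * g (n ∸ i))
        ≈⟨ solve 4 (λ a x b y → ((a :* x) :* (b :* y)) := ((a :* b) :* (x :* y))) refl _ _ _ _ ⟩
      (pow z i * pow z (n ∸ i)) * (f i * g (n ∸ i))   ≈⟨ *-cong (sym (pow-+ z i (n ∸ i))) refl ⟩
      pow z (i +ℕ (n ∸ i)) * (f i * g (n ∸ i))        ≡⟨ P.cong (λ m → pow z m * (f i * g (n ∸ i))) (NP.m+[n∸m]≡n i≤n) ⟩
      pow z n * (f i * g (n ∸ i))                     ∎

  β : PS
  β = tOverExpm1 1#

  β-0 : β 0 ≈ 1#
  β-0 = trans (⁻¹-cong (expm1DivT-0≉0 1≉0) (expm1DivT-0 1#)) 1⁻¹≈1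

  mulS-β-expm1DivT : mulS β (expm1DivT 1#) ≋ oneS
  mulS-β-expm1DivT = mulS-tOverExpm1-expm1DivT 1≉0

  γ : Carrier → PS
  γ b = scaleS (- b) β

  γ-0 : ∀ b → γ b 0 ≈ 1#
  γ-0 b = trans (*-identityˡ _) β-0

  -- Both sides are inverse to (e^{−bt} − 1)/(−bt).
  γ≋b*tOverExpm1*expS : ∀ {b} → ¬ b ≈ 0# → γ b ≋ mulS (constS b) (mulS (tOverExpm1 b) (expS b))
  γ≋b*tOverExpm1*expS {b} b≉0 = inverse-unique {q = q} γq≋1 (mulS-constS-cancel (-‿≉0 b≉0) (beginₛ
    mulS (constS (- b)) (mulS (mulS (constS b) (mulS τ E)) q)
      ≋⟨ solveₛ 5 (λ m X t e q → (m ⊗ ((X ⊗ (t ⊗ e)) ⊗ q)) ⊜ (X ⊗ (t ⊗ (e ⊗ (m ⊗ q))))) ≋-refl (constS (- b)) (constS b) τ E q ⟩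
    mulS (constS b) (mulS τ (mulS E (mulS (constS (- b)) q)))   ≋⟨ mulS-congʳ (constS b) (mulS-congʳ τ (mulS-congʳ E (≋-sym expm1DivT-neg≋))) ⟩
    mulS (constS b) (mulS τ (mulS E (expm1DivT (- b))))         ≋⟨ mulS-congʳ (constS b) (mulS-congʳ τ (expS-mulS-expm1DivT-neg b)) ⟩
    mulS (constS b) (mulS τ (-ₛ expm1DivT b))
      ≋⟨ solveₛ 3 (λ X t g → (X ⊗ (t ⊗ (⊝ g))) ⊜ (⊝ (X ⊗ (t ⊗ g)))) ≋-refl (constS b) τ (expm1DivT b) ⟩
    -ₛ mulS (constS b) (mulS τ (expm1DivT b))                   ≋⟨ -ₛ-cong (mulS-congʳ (constS b) (mulS-tOverExpm1-expm1DivT b≉0)) ⟩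
    -ₛ mulS (constS b) oneS                                     ≋⟨ -ₛ-cong (mulS-identityʳ (constS b)) ⟩
    -ₛ constS b                                                 ≋⟨ ≋-sym (constS-neg b) ⟩
    constS (- b)                                                ≋⟨ ≋-sym (mulS-identityʳ (constS (- b))) ⟩
    mulS (constS (- b)) oneS                                    ∎ₛ))
    where
    τ E q : PS
    τ = tOverExpm1 b
    E = expS b
    q = scaleS (- b) (expm1DivT 1#)
    γq≋1 : mulS (γ b) q ≋ oneS
    γq≋1 = beginₛ
      mulS (γ b) q                             ≋⟨ scaleS-mulS (- b) β (expm1DivT 1#) ⟩
      scaleS (- b) (mulS β (expm1DivT 1#))     ≋⟨ scaleS-cong (- b) mulS-β-expm1DivT ⟩
      scaleS (- b) oneS                        ≋⟨ scaleS-oneS (- b) ⟩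
      oneS                                     ∎ₛ
    expm1DivT-neg≋ : expm1DivT (- b) ≋ mulS (constS (- b)) q
    expm1DivT-neg≋ n = begin
      ((- b) * pow (- b) n) * invFact (suc n)                       ≈⟨ *-assoc _ _ _ ⟩
      (- b) * (pow (- b) n * invFact (suc n))
        ≈⟨ *-cong refl (*-cong refl (sym (trans (*-cong (pow-1# (suc n)) refl) (*-identityˡ _)))) ⟩
      (- b) * (pow (- b) n * (pow 1# (suc n) * invFact (suc n)))    ≈⟨ sym (mulS-constS (- b) q n) ⟩
      mulS (constS (- b)) q n                                       ∎

  -- Apply θ to τ g = 1, where g = (e^{bt} − 1)/t: θτ = −τ² θg, and θg = b e^{bt} − g.
  θ-tOverExpm1 : ∀ {b} → ¬ b ≈ 0# → θ (tOverExpm1 b) ≋ mulS (oneS +ₛ -ₛ γ b) (tOverExpm1 b)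
  θ-tOverExpm1 {b} b≉0 = beginₛ
    θτ                            ≋⟨ ≋-sym (mulS-identityʳ θτ) ⟩
    mulS θτ oneS                  ≋⟨ mulS-congʳ θτ (≋-sym τg≋1) ⟩
    mulS θτ (mulS τ g)
      ≋⟨ solveₛ 4 (λ A t g D → (A ⊗ (t ⊗ g)) ⊜ ((t ⊗ ((A ⊗ g) ⊕ (t ⊗ D))) ⊕ (⊝ (t ⊗ (t ⊗ D))))) ≋-refl θτ τ g (θ g) ⟩
    mulS τ (mulS θτ g +ₛ mulS τ (θ g)) +ₛ -ₛ mulS τ (mulS τ (θ g))
      ≋⟨ +ₛ-cong (mulS-congʳ τ θ[τg]≋0) ≋-refl ⟩
    mulS τ 0ₛ +ₛ -ₛ mulS τ (mulS τ (θ g))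
      ≋⟨ +ₛ-cong (mulS-zeroʳ τ) (-ₛ-cong (mulS-congʳ τ (mulS-congʳ τ (θ-expm1DivT b)))) ⟩
    0ₛ +ₛ -ₛ mulS τ (mulS τ (mulS (constS b) E +ₛ -ₛ g))
      ≋⟨ +ₛ-identityˡ _ ⟩
    -ₛ mulS τ (mulS τ (mulS (constS b) E +ₛ -ₛ g))
      ≋⟨ solveₛ 4 (λ t X E g → (⊝ (t ⊗ (t ⊗ ((X ⊗ E) ⊕ (⊝ g))))) ⊜ ((⊝ (t ⊗ (X ⊗ (t ⊗ E)))) ⊕ (t ⊗ (t ⊗ g))))
                  ≋-refl τ (constS b) E g ⟩
    -ₛ mulS τ (mulS (constS b) (mulS τ E)) +ₛ mulS τ (mulS τ g)
      ≋⟨ +ₛ-cong (-ₛ-cong (mulS-congʳ τ (≋-sym (γ≋b*tOverExpm1*expS b≉0)))) (mulS-congʳ τ τg≋1) ⟩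
    -ₛ mulS τ (γ b) +ₛ mulS τ oneS
      ≋⟨ solveₛ 3 (λ t c o → ((⊝ (t ⊗ c)) ⊕ (t ⊗ o)) ⊜ ((o ⊕ (⊝ c)) ⊗ t)) ≋-refl τ (γ b) oneS ⟩
    mulS (oneS +ₛ -ₛ γ b) τ       ∎ₛ
    where
    τ θτ g E : PS
    τ = tOverExpm1 b
    θτ = θ τ
    g = expm1DivT b
    E = expS b
    τg≋1 : mulS τ g ≋ oneS
    τg≋1 = mulS-tOverExpm1-expm1DivT b≉0
    θ[τg]≋0 : mulS θτ g +ₛ mulS τ (θ g) ≋ 0ₛ
    θ[τg]≋0 = beginₛ
      mulS θτ g +ₛ mulS τ (θ g)   ≋⟨ ≋-sym (θ-mulS τ g) ⟩
      θ (mulS τ g)                ≋⟨ θ-cong τg≋1 ⟩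
      θ oneS                      ≋⟨ θ-oneS ⟩
      0ₛ                          ∎ₛ

  θlog-prodT : ∀ {r} → Vec Carrier r → PS
  θlog-prodT [] = 0ₛ
  θlog-prodT (b ∷ bs) = (oneS +ₛ -ₛ γ b) +ₛ θlog-prodT bs

  θ-prodT : ∀ {r} (a : Vec Carrier r) → (∀ j → ¬ lookup a j ≈ 0#) → θ (prodT a) ≋ mulS (θlog-prodT a) (prodT a)
  θ-prodT [] _ = beginₛ
    θ oneS         ≋⟨ θ-oneS ⟩
    0ₛ             ≋⟨ ≋-sym (mulS-zeroˡ oneS) ⟩
    mulS 0ₛ oneS   ∎ₛ
  θ-prodT (b ∷ bs) a≉0 = beginₛ
    θ (mulS τ P)                                        ≋⟨ θ-mulS τ P ⟩
    mulS (θ τ) P +ₛ mulS τ (θ P)                        ≋⟨ +ₛ-cong (mulS-congˡ P (θ-tOverExpm1 (a≉0 fzero)))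
                                                                  (mulS-congʳ τ (θ-prodT bs (λ j → a≉0 (fsuc j)))) ⟩
    mulS (mulS D τ) P +ₛ mulS τ (mulS (θlog-prodT bs) P)
      ≋⟨ solveₛ 4 (λ D t S P → (((D ⊗ t) ⊗ P) ⊕ (t ⊗ (S ⊗ P))) ⊜ ((D ⊕ S) ⊗ (t ⊗ P))) ≋-refl D τ (θlog-prodT bs) P ⟩
    mulS (D +ₛ θlog-prodT bs) (mulS τ P)                ∎ₛ
    where
    τ P D : PS
    τ = tOverExpm1 b
    P = prodT bs
    D = oneS +ₛ -ₛ γ b

  prodT-∷ʳ-1# : ∀ {r} (a : Vec Carrier r) → prodT (a ∷ʳ 1#) ≋ mulS (prodT a) β
  prodT-∷ʳ-1# [] = λ n → trans (mulS-identityʳ β n) (sym (mulS-identityˡ β n))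
  prodT-∷ʳ-1# (b ∷ bs) = beginₛ
    mulS (tOverExpm1 b) (prodT (bs ∷ʳ 1#))       ≋⟨ mulS-congʳ (tOverExpm1 b) (prodT-∷ʳ-1# bs) ⟩
    mulS (tOverExpm1 b) (mulS (prodT bs) β)      ≋⟨ ≋-sym (mulS-assoc (tOverExpm1 b) (prodT bs) β) ⟩
    mulS (mulS (tOverExpm1 b) (prodT bs)) β      ∎ₛ

  -- Li_k(u)/u

  mulS-β-uS : mulS β uS ≋ mulS tS (expS (- 1#))
  mulS-β-uS = beginₛ
    mulS β (oneS +ₛ -ₛ E⁻)
      ≋⟨ solveₛ 3 (λ b o e → (b ⊗ (o ⊕ (⊝ e))) ⊜ (⊝ (b ⊗ (e ⊕ (⊝ o))))) ≋-refl β oneS E⁻ ⟩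
    -ₛ mulS β (E⁻ +ₛ -ₛ oneS)                         ≋⟨ -ₛ-cong (mulS-congʳ β (≋-sym (mulS-tS-expm1DivT (- 1#)))) ⟩
    -ₛ mulS β (mulS tS (expm1DivT (- 1#)))
      ≋⟨ solveₛ 3 (λ b t g → (⊝ (b ⊗ (t ⊗ g))) ⊜ (b ⊗ (t ⊗ (⊝ g)))) ≋-refl β tS (expm1DivT (- 1#)) ⟩
    mulS β (mulS tS (-ₛ expm1DivT (- 1#)))            ≋⟨ mulS-congʳ β (mulS-congʳ tS (≋-sym (expS-mulS-expm1DivT-neg (- 1#)))) ⟩
    mulS β (mulS tS (mulS E⁻ (expm1DivT (- (- 1#))))) ≋⟨ mulS-congʳ β (mulS-congʳ tS (mulS-congʳ E⁻ (expm1DivT-cong (-‿involutive 1#)))) ⟩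
    mulS β (mulS tS (mulS E⁻ (expm1DivT 1#)))
      ≋⟨ solveₛ 4 (λ b t e g → (b ⊗ (t ⊗ (e ⊗ g))) ⊜ ((t ⊗ e) ⊗ (b ⊗ g))) ≋-refl β tS E⁻ (expm1DivT 1#) ⟩
    mulS (mulS tS E⁻) (mulS β (expm1DivT 1#))         ≋⟨ mulS-congʳ (mulS tS E⁻) mulS-β-expm1DivT ⟩
    mulS (mulS tS E⁻) oneS                            ≋⟨ mulS-identityʳ (mulS tS E⁻) ⟩
    mulS tS E⁻                                        ∎ₛ
    where
    E⁻ : PS
    E⁻ = expS (- 1#)

  θ-uS : θ uS ≋ mulS β uS
  θ-uS = beginₛ
    θ (oneS +ₛ -ₛ E⁻)                     ≋⟨ θ-+ oneS (-ₛ E⁻) ⟩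
    θ oneS +ₛ θ (-ₛ E⁻)                   ≋⟨ +ₛ-cong θ-oneS (θ-neg E⁻) ⟩
    0ₛ +ₛ -ₛ θ E⁻                         ≋⟨ +ₛ-identityˡ _ ⟩
    -ₛ θ E⁻                               ≋⟨ -ₛ-cong (ODE⇒θ (ODE-expS (- 1#))) ⟩
    -ₛ mulS tS (mulS (constS (- 1#)) E⁻)  ≋⟨ -ₛ-cong (mulS-congʳ tS (mulS-congˡ E⁻ (≋-trans (constS-neg 1#) (-ₛ-cong constS-1#)))) ⟩
    -ₛ mulS tS (mulS (-ₛ oneS) E⁻)        ≋⟨ solveₛ 3 (λ t o e → (⊝ (t ⊗ ((⊝ o) ⊗ e))) ⊜ (t ⊗ (o ⊗ e))) ≋-refl tS oneS E⁻ ⟩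
    mulS tS (mulS oneS E⁻)                ≋⟨ mulS-congʳ tS (mulS-identityˡ E⁻) ⟩
    mulS tS E⁻                            ≋⟨ ≋-sym mulS-β-uS ⟩
    mulS β uS                             ∎ₛ
    where
    E⁻ : PS
    E⁻ = expS (- 1#)

  θ-powS-uS : ∀ m → θ (powS uS m) ≋ mulS (constS (ofℕ m)) (mulS β (powS uS m))
  θ-powS-uS zero = beginₛ
    θ oneS                         ≋⟨ θ-oneS ⟩
    0ₛ                             ≋⟨ ≋-sym (mulS-zeroˡ (mulS β oneS)) ⟩
    mulS 0ₛ (mulS β oneS)          ≋⟨ mulS-congˡ (mulS β oneS) (≋-sym constS-0#) ⟩
    mulS (constS 0#) (mulS β oneS) ∎ₛ
  θ-powS-uS (suc m) = beginₛ
    θ (mulS uS Uᵐ)                                    ≋⟨ θ-mulS uS Uᵐ ⟩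
    mulS (θ uS) Uᵐ +ₛ mulS uS (θ Uᵐ)                  ≋⟨ +ₛ-cong (mulS-congˡ Uᵐ θ-uS) (mulS-congʳ uS (θ-powS-uS m)) ⟩
    mulS (mulS β uS) Uᵐ +ₛ mulS uS (mulS M (mulS β Uᵐ))
      ≋⟨ solveₛ 4 (λ b u V M → (((b ⊗ u) ⊗ V) ⊕ (u ⊗ (M ⊗ (b ⊗ V)))) ⊜ ((b ⊕ (M ⊗ b)) ⊗ (u ⊗ V))) ≋-refl β uS Uᵐ M ⟩
    mulS (β +ₛ mulS M β) (mulS uS Uᵐ)                 ≋⟨ mulS-congˡ (mulS uS Uᵐ) β+mβ≋[1+m]β ⟩
    mulS (mulS (constS (ofℕ (suc m))) β) (mulS uS Uᵐ) ≋⟨ mulS-assoc (constS (ofℕ (suc m))) β (mulS uS Uᵐ) ⟩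
    mulS (constS (ofℕ (suc m))) (mulS β (mulS uS Uᵐ)) ∎ₛ
    where
    Uᵐ M : PS
    Uᵐ = powS uS m
    M = constS (ofℕ m)
    β+mβ≋[1+m]β : β +ₛ mulS M β ≋ mulS (constS (ofℕ (suc m))) β
    β+mβ≋[1+m]β = beginₛ
      β +ₛ mulS M β                      ≋⟨ +ₛ-cong (≋-sym (mulS-identityˡ β)) ≋-refl ⟩
      mulS oneS β +ₛ mulS M β            ≋⟨ ≋-sym (mulS-distribʳ oneS M β) ⟩
      mulS (oneS +ₛ M) β                 ≋⟨ mulS-congˡ β (≋-sym (≋-trans (constS-+ 1# (ofℕ m)) (+ₛ-cong constS-1# ≋-refl))) ⟩
      mulS (constS (ofℕ (suc m))) β      ∎ₛ

  uS-0 : uS 0 ≈ 0#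
  uS-0 = trans (+-cong refl (-‿cong (expS-0 (- 1#)))) (-‿inverseʳ 1#)

  powS-uS-low : ∀ m j → j < m → powS uS m j ≈ 0#
  powS-uS-low (suc m) j (s≤s j≤m) = sumTo-≈0 j _ term≈0
    where
    term≈0 : ∀ i → i ≤ j → uS i * powS uS m (j ∸ i) ≈ 0#
    term≈0 zero _ = trans (*-cong uS-0 refl) (zeroˡ _)
    term≈0 (suc i) (s≤s {n = j′} i≤j′) =
      trans (*-cong refl (powS-uS-low m (j′ ∸ i) (NP.<-≤-trans (s≤s (NP.m∸n≤m j′ i)) j≤m))) (zeroʳ _)

  mulS-congʳ-≤ : ∀ f {g g′} n → (∀ j → j ≤ n → g j ≈ g′ j) → mulS f g n ≈ mulS f g′ n
  mulS-congʳ-≤ f n g≈g′ = sumTo-cong n (λ i → *-cong refl (g≈g′ (n ∸ i) (NP.m∸n≤m n i)))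

  mulS-*ʳ : ∀ f g z n → mulS f (λ j → g j * z) n ≈ mulS f g n * z
  mulS-*ʳ f g z n = trans (sumTo-cong n (λ i → sym (*-assoc _ _ _))) (sym (sumTo-*ʳ n z _))

  mulS-sumTo : ∀ f N (A : ℕ → PS) n → mulS f (λ j → sumTo N (λ m → A m j)) n ≈ sumTo N (λ m → mulS f (A m) n)
  mulS-sumTo f N A n = trans (sumTo-cong n (λ i → sumTo-*ˡ N (f i) _)) (sumTo-swap n N _)

  liOverU≤ : ℕ → ℤ → PS
  liOverU≤ N k j = sumTo N (λ m → powS uS m j * invPowInt k m)

  -- u^m has order m, so only the terms m ≤ j contribute to the coefficient of t^j.
  liOverU≈liOverU≤ : ∀ k {j N} → j ≤ N → liOverU k j ≈ liOverU≤ N k j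
  liOverU≈liOverU≤ k {j} {N} j≤N = sym (sumTo-truncate j N _ j≤N
    (λ m j<m _ → trans (*-cong (powS-uS-low m j j<m) refl) (zeroˡ _)))

  invPowInt-pred : ∀ k m → invPowInt (k - + 1) m ≈ ofℕ (suc m) * invPowInt k m
  invPowInt-pred (+ zero) m = *-cong refl (sym 1⁻¹≈1)
  invPowInt-pred (+ suc p) m = sym (begin
    N * (N * pow N p) ⁻¹          ≈⟨ *-cong refl (⁻¹-distrib-* (charZero m) (pow-≉0 p (charZero m))) ⟩
    N * (N ⁻¹ * (pow N p) ⁻¹)     ≈⟨ sym (*-assoc _ _ _) ⟩
    (N * N ⁻¹) * (pow N p) ⁻¹     ≈⟨ *-cong (⁻¹-inverse N (charZero m)) refl ⟩
    1# * (pow N p) ⁻¹             ≈⟨ *-identityˡ _ ⟩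
    (pow N p) ⁻¹                  ∎)
    where
    N : Carrier
    N = ofℕ (suc m)
  invPowInt-pred -[1+ p ] m = reflexive (P.cong (λ q → pow (ofℕ (suc m)) (suc (suc q))) (NP.+-identityʳ p))

  m*invPowInt : ∀ k m → ofℕ m * invPowInt k m ≈ invPowInt (k - + 1) m + - invPowInt k m
  m*invPowInt k m = begin
    ofℕ m * w                          ≈⟨ solve 2 (λ M w → (M :* w) := (((w :+ (M :* w))) :+ (:- w))) refl (ofℕ m) w ⟩
    (w + ofℕ m * w) + - w              ≈⟨ +-cong (sym (trans (invPowInt-pred k m) (trans (distribʳ _ _ _) (+-cong (*-identityˡ _) refl)))) refl ⟩
    invPowInt (k - + 1) m + - w        ∎
    where
    w : Carrier
    w = invPowInt k m

  θ-liOverU≤ : ∀ N k → θ (liOverU≤ N k) ≋ mulS β (liOverU≤ N (k - + 1) +ₛ -ₛ liOverU≤ N k)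
  θ-liOverU≤ N k j = begin
    ofℕ j * sumTo N (λ m → U m j * w m)                      ≈⟨ sumTo-*ˡ N _ _ ⟩
    sumTo N (λ m → ofℕ j * (U m j * w m))                    ≈⟨ sumTo-cong N (λ m → θ-term m) ⟩
    sumTo N (λ m → mulS β (λ i → U m i * Δw m) j)            ≈⟨ sym (mulS-sumTo β N (λ m i → U m i * Δw m) j) ⟩
    mulS β (λ i → sumTo N (λ m → U m i * Δw m)) j            ≈⟨ mulS-congʳ β split j ⟩
    mulS β (liOverU≤ N (k - + 1) +ₛ -ₛ liOverU≤ N k) j       ∎
    where
    U : ℕ → PS
    U = powS uS
    w : ℕ → Carrier
    w = invPowInt k
    Δw : ℕ → Carrier
    Δw m = invPowInt (k - + 1) m + - w m
    θ-term : ∀ m → ofℕ j * (U m j * w m) ≈ mulS β (λ i → U m i * Δw m) j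
    θ-term m = begin
      ofℕ j * (U m j * w m)                   ≈⟨ sym (*-assoc _ _ _) ⟩
      θ (U m) j * w m                         ≈⟨ *-cong (trans (θ-powS-uS m j) (mulS-constS (ofℕ m) (mulS β (U m)) j)) refl ⟩
      (ofℕ m * mulS β (U m) j) * w m          ≈⟨ solve 3 (λ M x w → ((M :* x) :* w) := (x :* (M :* w))) refl _ _ _ ⟩
      mulS β (U m) j * (ofℕ m * w m)          ≈⟨ *-cong refl (m*invPowInt k m) ⟩
      mulS β (U m) j * Δw m                   ≈⟨ sym (mulS-*ʳ β (U m) (Δw m) j) ⟩
      mulS β (λ i → U m i * Δw m) j           ∎
    split : (λ i → sumTo N (λ m → U m i * Δw m)) ≋ liOverU≤ N (k - + 1) +ₛ -ₛ liOverU≤ N k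
    split i = begin
      sumTo N (λ m → U m i * Δw m)
        ≈⟨ sumTo-cong N (λ m → solve 3 (λ u a b → (u :* (a :+ (:- b))) := ((u :* a) :+ (:- (u :* b)))) refl _ _ _) ⟩
      sumTo N (λ m → U m i * invPowInt (k - + 1) m + - (U m i * w m))
        ≈⟨ trans (sumTo-+ N _ _) (+-cong refl (sym (sumTo-neg N _))) ⟩
      liOverU≤ N (k - + 1) i + - liOverU≤ N k i                  ∎

  θ-liOverU : ∀ k → θ (liOverU k) ≋ mulS β (liOverU (k - + 1) +ₛ -ₛ liOverU k)
  θ-liOverU k n = begin
    ofℕ n * liOverU k n                                  ≈⟨ *-cong refl (liOverU≈liOverU≤ k {n} NP.≤-refl) ⟩
    θ (liOverU≤ n k) n                                   ≈⟨ θ-liOverU≤ n k n ⟩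
    mulS β (liOverU≤ n (k - + 1) +ₛ -ₛ liOverU≤ n k) n
      ≈⟨ mulS-congʳ-≤ β n (λ j j≤n → sym (+-cong (liOverU≈liOverU≤ (k - + 1) j≤n) (-‿cong (liOverU≈liOverU≤ k j≤n)))) ⟩
    mulS β (liOverU (k - + 1) +ₛ -ₛ liOverU k) n         ∎

  -- The generating function of S

  [1-g]*f-suc : ∀ (g f : PS) → g 0 ≈ 1# → ∀ n → mulS (oneS +ₛ -ₛ g) f (suc n) ≈ - sumTo n (λ l → f l * g (suc n ∸ l))
  [1-g]*f-suc g f g₀≈1 n = begin
    mulS (oneS +ₛ -ₛ g) f (suc n)              ≈⟨ mulS-distribʳ oneS (-ₛ g) f (suc n) ⟩
    mulS oneS f (suc n) + mulS (-ₛ g) f (suc n) ≈⟨ +-cong (mulS-identityˡ f (suc n)) (mulS-neg (suc n)) ⟩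
    f (suc n) + - mulS g f (suc n)             ≈⟨ +-cong refl (-‿cong (mulS-comm g f (suc n))) ⟩
    f (suc n) + - (Σ + f (suc n) * g (n ∸ n))  ≈⟨ +-cong refl (-‿cong (+-cong refl (trans (*-cong refl g[n∸n]≈1) (*-identityʳ _)))) ⟩
    f (suc n) + - (Σ + f (suc n))              ≈⟨ solve 2 (λ y s → (y :+ (:- (s :+ y))) := (:- s)) refl _ _ ⟩
    - Σ                                        ∎
    where
    Σ : Carrier
    Σ = sumTo n (λ l → f l * g (suc n ∸ l))
    g[n∸n]≈1 : g (n ∸ n) ≈ 1#
    g[n∸n]≈1 = trans (reflexive (P.cong g (NP.n∸n≡0 n))) g₀≈1
    mulS-neg : mulS (-ₛ g) f ≋ -ₛ mulS g f
    mulS-neg = solveₛ 2 (λ g f → ((⊝ g) ⊗ f) ⊜ (⊝ (g ⊗ f))) ≋-refl g f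

  θlog-prodT-suc : ∀ {r} (a : Vec Carrier r) (f : PS) n →
    mulS (θlog-prodT a) f (suc n) ≈ - sumVec a (λ b → sumTo n (λ l → f l * γ b (suc n ∸ l)))
  θlog-prodT-suc [] f n = trans (mulS-zeroˡ f (suc n)) (sym -0#≈0#)
  θlog-prodT-suc (b ∷ bs) f n = begin
    mulS ((oneS +ₛ -ₛ γ b) +ₛ θlog-prodT bs) f (suc n)   ≈⟨ mulS-distribʳ _ (θlog-prodT bs) f (suc n) ⟩
    mulS (oneS +ₛ -ₛ γ b) f (suc n) + mulS (θlog-prodT bs) f (suc n)
      ≈⟨ +-cong ([1-g]*f-suc (γ b) f (γ-0 b) n) (θlog-prodT-suc bs f n) ⟩
    - sumTo n (λ l → f l * γ b (suc n ∸ l)) + - sumVec bs (λ b → sumTo n (λ l → f l * γ b (suc n ∸ l)))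
      ≈⟨ -‿+-comm _ _ ⟩
    - sumVec (b ∷ bs) (λ b → sumTo n (λ l → f l * γ b (suc n ∸ l)))   ∎

  genS-∷ʳ-1#-difference : ∀ k x {r} (a : Vec Carrier r) →
    genS k x (a ∷ʳ 1#) +ₛ -ₛ genS (k - + 1) x (a ∷ʳ 1#) ≋
      mulS (mulS (mulS (prodT a) β) (liOverU k +ₛ -ₛ liOverU (k - + 1))) (expS x)
  genS-∷ʳ-1#-difference k x a = beginₛ
    genS k x (a ∷ʳ 1#) +ₛ -ₛ genS (k - + 1) x (a ∷ʳ 1#)
      ≋⟨ +ₛ-cong (mulS-congˡ E (mulS-congˡ L (prodT-∷ʳ-1# a))) (-ₛ-cong (mulS-congˡ E (mulS-congˡ L′ (prodT-∷ʳ-1# a)))) ⟩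
    mulS (mulS (mulS P β) L) E +ₛ -ₛ mulS (mulS (mulS P β) L′) E
      ≋⟨ solveₛ 5 (λ p b l l′ e → ((((p ⊗ b) ⊗ l) ⊗ e) ⊕ (⊝ (((p ⊗ b) ⊗ l′) ⊗ e))) ⊜ (((p ⊗ b) ⊗ (l ⊕ (⊝ l′))) ⊗ e))
                  ≋-refl P β L L′ E ⟩
    mulS (mulS (mulS P β) (L +ₛ -ₛ L′)) E                        ∎ₛ
    where
    P L L′ E : PS
    P = prodT a
    L = liOverU k
    L′ = liOverU (k - + 1)
    E = expS x

  θ-genS : ∀ k x {r} (a : Vec Carrier r) → (∀ j → ¬ lookup a j ≈ 0#) →
    θ (genS k x a) ≋
      (mulS (θlog-prodT a) (genS k x a) +ₛ -ₛ (genS k x (a ∷ʳ 1#) +ₛ -ₛ genS (k - + 1) x (a ∷ʳ 1#)))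
        +ₛ mulS tS (mulS (constS x) (genS k x a))
  θ-genS k x a a≉0 = beginₛ
    θ (mulS (mulS P L) E)                                    ≋⟨ θ-mulS (mulS P L) E ⟩
    mulS (θ (mulS P L)) E +ₛ mulS (mulS P L) (θ E)
      ≋⟨ +ₛ-cong (mulS-congˡ E θ[PL]) (mulS-congʳ (mulS P L) (ODE⇒θ (ODE-expS x))) ⟩
    mulS (mulS (mulS δ P) L +ₛ mulS P (mulS β (L′ +ₛ -ₛ L))) E +ₛ mulS (mulS P L) (mulS tS (mulS X E))
      ≋⟨ solveₛ 8 (λ s p l l′ b e t y →
            (((((s ⊗ p) ⊗ l) ⊕ (p ⊗ (b ⊗ (l′ ⊕ (⊝ l))))) ⊗ e) ⊕ ((p ⊗ l) ⊗ (t ⊗ (y ⊗ e))))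
            ⊜ (((s ⊗ ((p ⊗ l) ⊗ e)) ⊕ (⊝ (((p ⊗ b) ⊗ (l ⊕ (⊝ l′))) ⊗ e))) ⊕ (t ⊗ (y ⊗ ((p ⊗ l) ⊗ e)))))
          ≋-refl δ P L L′ β E tS X ⟩
    (mulS δ G +ₛ -ₛ mulS (mulS (mulS P β) (L +ₛ -ₛ L′)) E) +ₛ mulS tS (mulS X G)
      ≋⟨ +ₛ-cong (+ₛ-cong ≋-refl (-ₛ-cong (≋-sym (genS-∷ʳ-1#-difference k x a)))) ≋-refl ⟩
    (mulS δ G +ₛ -ₛ (genS k x (a ∷ʳ 1#) +ₛ -ₛ genS (k - + 1) x (a ∷ʳ 1#))) +ₛ mulS tS (mulS X G) ∎ₛ
    where
    P L L′ E X G δ : PS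
    P = prodT a
    L = liOverU k
    L′ = liOverU (k - + 1)
    E = expS x
    X = constS x
    G = genS k x a
    δ = θlog-prodT a
    θ[PL] : θ (mulS P L) ≋ mulS (mulS δ P) L +ₛ mulS P (mulS β (L′ +ₛ -ₛ L))
    θ[PL] = beginₛ
      θ (mulS P L)                   ≋⟨ θ-mulS P L ⟩
      mulS (θ P) L +ₛ mulS P (θ L)   ≋⟨ +ₛ-cong (mulS-congˡ L (θ-prodT a a≉0)) (mulS-congʳ P (θ-liOverU k)) ⟩
      mulS (mulS δ P) L +ₛ mulS P (mulS β (L′ +ₛ -ₛ L)) ∎ₛ

  genS-recurrence : ∀ k x {r} (a : Vec Carrier r) → (∀ j → ¬ lookup a j ≈ 0#) → ∀ n →
    ofℕ (suc n) * genS k x a (suc n) ≈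
      (- sumVec a (λ b → sumTo n (λ l → genS k x a l * γ b (suc n ∸ l)))
        + - (genS k x (a ∷ʳ 1#) (suc n) + - genS (k - + 1) x (a ∷ʳ 1#) (suc n)))
      + x * genS k x a n
  genS-recurrence k x a a≉0 n = trans (θ-genS k x a a≉0 (suc n))
    (+-cong (+-cong (θlog-prodT-suc a G n) refl) (trans (mulS-tS-suc (mulS (constS x) G) n) (mulS-constS x G n)))
    where
    G : PS
    G = genS k x a

  [1+n]!≈n!*[1+n] : ∀ n → ofℕ (suc n !) ≈ ofℕ (n !) * ofℕ (suc n)
  [1+n]!≈n!*[1+n] n = trans (ofℕ-* (suc n) (n !)) (*-comm _ _)

  [1+n]⁻¹*[1+n]!≈n! : ∀ n → ofℕ (suc n) ⁻¹ * ofℕ (suc n !) ≈ ofℕ (n !)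
  [1+n]⁻¹*[1+n]!≈n! n = begin
    N ⁻¹ * ofℕ (suc n !)       ≈⟨ *-cong refl (ofℕ-* (suc n) (n !)) ⟩
    N ⁻¹ * (N * ofℕ (n !))     ≈⟨ sym (*-assoc _ _ _) ⟩
    (N ⁻¹ * N) * ofℕ (n !)     ≈⟨ *-cong (⁻¹-inverseˡ (charZero n)) refl ⟩
    1# * ofℕ (n !)             ≈⟨ *-identityˡ _ ⟩
    ofℕ (n !)                  ∎
    where
    N : Carrier
    N = ofℕ (suc n)

  [1+n]⁻¹*[[1+n]!*u-[1+n]!*v]≈n!*[u-v] : ∀ n u v →
    ofℕ (suc n) ⁻¹ * (ofℕ (suc n !) * u + - (ofℕ (suc n !) * v)) ≈ ofℕ (n !) * (u + - v)
  [1+n]⁻¹*[[1+n]!*u-[1+n]!*v]≈n!*[u-v] n u v = trans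
    (solve 4 (λ i f u v → (i :* ((f :* u) :+ (:- (f :* v)))) := ((i :* f) :* (u :+ (:- v)))) refl _ _ _ _)
    (*-cong ([1+n]⁻¹*[1+n]!≈n! n) refl)

  binom*pow*B*l!≈[1+n]!*γ : ∀ (f : PS) b {n l} → l ≤ n →
    binom (suc n) l * pow (- b) (suc n ∸ l) * B (suc n ∸ l) * (ofℕ (l !) * f l) ≈ ofℕ (suc n !) * (f l * γ b (suc n ∸ l))
  binom*pow*B*l!≈[1+n]!*γ f b {n} {l} l≤n = begin
    ((K * p) * (M * β m)) * (ofℕ (l !) * f l)
      ≈⟨ solve 6 (λ C p M bm Lf y → (((C :* p) :* (M :* bm)) :* (Lf :* y)) := ((C :* (Lf :* M)) :* (y :* (p :* bm)))) refl _ _ _ _ _ _ ⟩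
    (K * (ofℕ (l !) * M)) * (f l * (p * β m))    ≈⟨ *-cong K*l!*m!≈[1+n]! refl ⟩
    ofℕ (suc n !) * (f l * γ b m)                ∎
    where
    m : ℕ
    m = suc n ∸ l
    K p M : Carrier
    K = binom (suc n) l
    p = pow (- b) m
    M = ofℕ (m !)
    K*l!*m!≈[1+n]! : K * (ofℕ (l !) * M) ≈ ofℕ (suc n !)
    K*l!*m!≈[1+n]! = begin
      K * (ofℕ (l !) * M)                    ≈⟨ *-cong refl (sym (ofℕ-* (l !) (m !))) ⟩
      K * ofℕ (l ! *ℕ m !)                   ≈⟨ sym (ofℕ-* (suc n C l) (l ! *ℕ m !)) ⟩
      ofℕ ((suc n C l) *ℕ (l ! *ℕ m !))     ≡⟨ P.cong ofℕ (nCk*[k!*[n∸k]!]≡n! (NP.m≤n⇒m≤1+n l≤n)) ⟩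
      ofℕ (suc n !)                          ∎

  bernoulli-sum : ∀ (f : PS) {r} (a : Vec Carrier r) n →
    ofℕ (suc n) ⁻¹ * sumVec a (λ b → sumTo n (λ l → binom (suc n) l * pow (- b) (suc n ∸ l) * B (suc n ∸ l) * (ofℕ (l !) * f l)))
      ≈ ofℕ (n !) * sumVec a (λ b → sumTo n (λ l → f l * γ b (suc n ∸ l)))
  bernoulli-sum f a n = begin
    N ⁻¹ * sumVec a (λ b → sumTo n (λ l → binom (suc n) l * pow (- b) (suc n ∸ l) * B (suc n ∸ l) * (ofℕ (l !) * f l)))
      ≈⟨ *-cong refl (sumVec-cong a (λ b → sumTo-cong-≤ n (λ l l≤n → binom*pow*B*l!≈[1+n]!*γ f b l≤n))) ⟩
    N ⁻¹ * sumVec a (λ b → sumTo n (λ l → ofℕ (suc n !) * (f l * γ b (suc n ∸ l))))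
      ≈⟨ *-cong refl (trans (sumVec-cong a (λ b → sym (sumTo-*ˡ n _ _))) (sym (sumVec-*ˡ a _ _))) ⟩
    N ⁻¹ * (ofℕ (suc n !) * ΣΣ)   ≈⟨ sym (*-assoc _ _ _) ⟩
    (N ⁻¹ * ofℕ (suc n !)) * ΣΣ   ≈⟨ *-cong ([1+n]⁻¹*[1+n]!≈n! n) refl ⟩
    ofℕ (n !) * ΣΣ                ∎
    where
    N ΣΣ : Carrier
    N = ofℕ (suc n)
    ΣΣ = sumVec a (λ b → sumTo n (λ l → f l * γ b (suc n ∸ l)))

theorem3 : ∀ {c ℓ} (F : CharZeroField c ℓ) → let open CharZeroField F hiding (_-_) in let open Series F in
    (r : ℕ) → 0 < r → (k : ℤ) → (a : Vec Carrier r) → (∀ j → ¬ (lookup a j ≈ 0#)) →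
    (x : Carrier) → (n : ℕ) →
      S (suc n) k x a ≈
        ((x * S n k x a)
          + (- (((ofℕ (suc n)) ⁻¹) * sumVec a (λ aj → sumTo n (λ l →
                binom (suc n) l * pow (- aj) (suc n ∸ l) * B (suc n ∸ l) * S l k x a)))))
        + (- (((ofℕ (suc n)) ⁻¹) * (S (suc n) k x (a ∷ʳ 1#) + (- S (suc n) (k - + 1) x (a ∷ʳ 1#)))))
theorem3 F r _ k a a≉0 x n = begin
  ofℕ (suc n !) * G (suc n)                   ≈⟨ *-cong ([1+n]!≈n!*[1+n] n) refl ⟩
  (ofℕ (n !) * ofℕ (suc n)) * G (suc n)       ≈⟨ *-assoc _ _ _ ⟩
  ofℕ (n !) * (ofℕ (suc n) * G (suc n))       ≈⟨ *-cong refl (genS-recurrence k x a a≉0 n) ⟩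
  ofℕ (n !) * ((- ΣΣ + - Δ) + x * G n)
    ≈⟨ solve 5 (λ q s h x g → (q :* (((:- s) :+ (:- h)) :+ (x :* g))) := (((x :* (q :* g)) :+ (:- (q :* s))) :+ (:- (q :* h)))) refl _ _ _ _ _ ⟩
  (x * S n k x a + - (ofℕ (n !) * ΣΣ)) + - (ofℕ (n !) * Δ)
    ≈⟨ +-cong (+-cong refl (-‿cong (sym (bernoulli-sum G a n))))
              (-‿cong (sym ([1+n]⁻¹*[[1+n]!*u-[1+n]!*v]≈n!*[u-v] n _ _))) ⟩
  _                                           ∎
  where
  open CharZeroField F hiding (_-_)
  open Series F
  open Properties F
  open IntegerCoefficients commRing using (solve; _:+_; _:*_; :-_; _:=_)
  open SetoidReasoning setoid
  G : PS
  G = genS k x a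
  ΣΣ Δ : Carrier
  ΣΣ = sumVec a (λ b → sumTo n (λ l → G l * γ b (suc n ∸ l)))
  Δ = genS k x (a ∷ʳ 1#) (suc n) + - genS (k - + 1) x (a ∷ʳ 1#) (suc n)
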